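{- Let $G$ be a graph and let $X_1,\dots,X_\ell \subseteq V(G)$ be pairwise disjoint sets such that $G[X_i,X_{i+1}]$ is a non-empty biregular graph for all $i \in [\ell-1]$. Let $k = \min_{i \in [\ell]} |X_i|$. Then there exist $k$ vertex-disjoint paths from $X_1$ to $X_\ell$, i.e., there are distinct vertices $v_{i,j} \in X_i$ for $i \in [\ell]$, $j \in [k]$ such that $v_{i,j}v_{i+1,j} \in E(G)$ for all $i \in [\ell-1]$ and $j \in [k]$.
   Context: For $A,B\subseteq V(G)$, $G[A,B]$ is the graph with vertex set $A\cup B$ and edge set $\{vw\in E(G)\mid v\in A,w\in B\}$. A bipartite graph with sides $A,B$ is biregular if there are $d_1,d_2$ such that every vertex of $A$ has degree $d_1$ and every vertex of $B$ has degree $d_2$; non-empty means it has at least one edge. $[m]=\{1,\dots,m\}$. -}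

module Defs where

open import Data.Nat using (ℕ; _⊓_)
open import Data.Bool using (Bool; true; false)
open import Data.Fin using (Fin; zero; suc; inject₁)
open import Data.Fin.Subset using (Subset; _∈_; _∩_; ∣_∣)
open import Data.Vec using (tabulate)
open import Data.Product using (Σ; ∃; _×_; _,_)
open import Relation.Binary.PropositionalEquality using (_≡_; _≢_)
open import Relation.Nullary using (¬_)

record Graph (n : ℕ) : Set where
  field
    adj    : Fin n → Fin n → Bool
    sym    : ∀ u v → adj u v ≡ adj v u
    irrefl : ∀ v → adj v v ≡ false
open Graph public

N : ∀ {n} → Graph n → Fin n → Subset n
N G v = tabulate (adj G v)

degIn : ∀ {n} → Graph n → Fin n → Subset n → ℕ
degIn G v B = ∣ N G v ∩ B ∣

Disjoint : ∀ {n} → Subset n → Subset n → Set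
Disjoint A B = ∀ v → v ∈ A → ¬ (v ∈ B)

-- G[A,B] is biregular (for disjoint A, B, the degree of v ∈ A in G[A,B] is degIn G v B)
Biregular : ∀ {n} → Graph n → Subset n → Subset n → Set
Biregular G A B = Σ ℕ λ d₁ → Σ ℕ λ d₂ →
  (∀ v → v ∈ A → degIn G v B ≡ d₁) × (∀ w → w ∈ B → degIn G w A ≡ d₂)

NonEmpty : ∀ {n} → Graph n → Subset n → Subset n → Set
NonEmpty G A B = Σ _ λ v → Σ _ λ w → v ∈ A × w ∈ B × adj G v w ≡ true

minOver : ∀ m → (Fin (ℕ.suc m) → ℕ) → ℕ
minOver ℕ.zero f = f zero
minOver (ℕ.suc m) f = f zero ⊓ minOver m (λ i → f (suc i))

-- Fix a smallest layer X_p, of size k, and grow k paths from X_p outwards in both directions. The layers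
-- X_p, X_{p+1}, …, X_m are handled by one application of Hall's theorem: match L = X_p ∪ … ∪ X_{m-1} into
-- R = X_{p+1} ∪ … ∪ X_m, allowing a vertex to be matched either along an edge into the next layer or to
-- itself. Iterating the matching from a vertex of X_p moves one layer further at every step, because a
-- vertex matched to itself would be the mate of two vertices. For S ⊆ L write s_i = |S ∩ X_i| and
-- u_i = |N(S) ∩ X_{i+1}|; double counting the edges of the biregular graph G[X_i, X_{i+1}] gives
-- s_i / |X_i| ≤ u_i / |X_{i+1}|, the loops give s_{i+1} ≤ u_i, and since |X_p| ≤ |X_i| these combine to
-- Σ s_i ≤ Σ u_i, which is Hall's condition. The layers X_p, X_{p-1}, …, X_0 are treated the same way.
module Submission where

open import Defs renaming (sym to adj-sym)

open import Data.Nat using (ℕ; zero; suc; _+_; _*_; _∸_; _≤_; _<_; z≤n; s≤s; z<s; s<s; >-nonZero)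
open import Data.Nat.Properties
open import Data.Nat.GeneralisedArithmetic using (fold)
open import Data.Nat.Tactic.RingSolver using (solve-∀)
open import Data.Bool using (Bool; true; false; _∧_; _∨_; not; if_then_else_)
import Data.Bool as Bool
open import Data.Bool.Properties
  using (not-involutive; ∧-conicalˡ; ∧-conicalʳ; ∧-zeroʳ; ∧-identityʳ; ∧-distribˡ-∨; ∨-identityʳ; ∨-zeroʳ)
open import Data.Fin using (Fin; toℕ; fromℕ<; inject₁) renaming (zero to fzero; suc to fsuc)
open import Data.Fin.Properties using (all?) renaming (_≟_ to _≟ᶠ_)
import Data.Fin.Properties as Finₚ
open import Data.Fin.Subset using (Subset; _∈_; ∣_∣) renaming (_∩_ to _∩ˢ_)
open import Data.Fin.Subset.Properties using (anySubset?)
open import Data.Vec using ([]; _∷_; lookup; tabulate)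
open import Data.Vec.Properties using (lookup∘tabulate; lookup-zipWith; lookup⇒[]=; []=⇒lookup)
open import Data.Product using (Σ; _×_; _,_; proj₁; proj₂)
open import Data.Sum using (_⊎_; inj₁; inj₂)
open import Data.Empty using (⊥-elim)
open import Relation.Nullary using (Dec; does; yes; no; ¬_)
open import Relation.Nullary.Decidable using (map′; _×-dec_; _→-dec_; dec-true; decidable-stable)
open import Relation.Binary.PropositionalEquality
  using (_≡_; _≢_; refl; sym; trans; cong; subst; subst₂; module ≡-Reasoning)
open import Function using (_∘_; case_of_)
open import Algebra.Properties.CommutativeSemigroup *-commutativeSemigroup using (x∙yz≈y∙xz; x∙yz≈yx∙z)
open import Algebra.Properties.Semiring.Sum +-*-semiring using (sum; ∑-distrib-+; ∑-comm; sum-cong-≗; *-distribʳ-sum)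

-- Counting

∧-intro : ∀ {a b} → a ≡ true → b ≡ true → a ∧ b ≡ true
∧-intro refl refl = refl

∨-introˡ : ∀ {a} b → a ≡ true → a ∨ b ≡ true
∨-introˡ b refl = refl

∨-introʳ : ∀ a {b} → b ≡ true → a ∨ b ≡ true
∨-introʳ a refl = ∨-zeroʳ a

∨-by-cases : ∀ a {b} → (a ≡ false → b ≡ true) → a ∨ b ≡ true
∨-by-cases true _ = refl
∨-by-cases false b = b refl

∧-≡false : ∀ a {b} → (b ≡ true → a ≡ false) → a ∧ b ≡ false
∧-≡false false _ = refl
∧-≡false true {false} _ = refl
∧-≡false true {true} b⇒¬a = b⇒¬a refl

∨-elim : ∀ {a b} → a ∨ b ≡ true → a ≡ true ⊎ b ≡ true
∨-elim {true} _ = inj₁ refl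
∨-elim {false} b = inj₂ b

indicator : Bool → ℕ
indicator true = 1
indicator false = 0

count : ∀ {n} → (Fin n → Bool) → ℕ
count P = sum (indicator ∘ P)

infix 4 _⊆_
infixr 6 _∪_
infixr 7 _∩_
infixl 6 _∖_

_⊆_ : ∀ {n} → (Fin n → Bool) → (Fin n → Bool) → Set
P ⊆ Q = ∀ x → P x ≡ true → Q x ≡ true

_∪_ _∩_ _∖_ : ∀ {n} → (Fin n → Bool) → (Fin n → Bool) → Fin n → Bool
(P ∪ Q) x = P x ∨ Q x
(P ∩ Q) x = P x ∧ Q x
(P ∖ Q) x = P x ∧ not (Q x)

⁅_⁆ : ∀ {n} → Fin n → Fin n → Bool
⁅ x₀ ⁆ x = does (x ≟ᶠ x₀)

count-cong : ∀ {n} {P Q : Fin n → Bool} → (∀ x → P x ≡ Q x) → count P ≡ count Q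
count-cong P≗Q = sum-cong-≗ (cong indicator ∘ P≗Q)

sum-mono : ∀ {n} {f g : Fin n → ℕ} → (∀ x → f x ≤ g x) → sum f ≤ sum g
sum-mono {zero} f≤g = z≤n
sum-mono {suc n} f≤g = +-mono-≤ (f≤g fzero) (sum-mono (f≤g ∘ fsuc))

count-mono : ∀ {n} {P Q : Fin n → Bool} → P ⊆ Q → count P ≤ count Q
count-mono {P = P} {Q} P⊆Q = sum-mono λ x → indicator-mono (P x) (Q x) (P⊆Q x)
  where
  indicator-mono : ∀ a b → (a ≡ true → b ≡ true) → indicator a ≤ indicator b
  indicator-mono false b _ = z≤n
  indicator-mono true b a⇒b rewrite a⇒b refl = ≤-refl

count-empty : ∀ {n} {P : Fin n → Bool} → (∀ x → P x ≡ false) → count P ≡ 0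
count-empty {zero} _ = refl
count-empty {suc n} {P} none rewrite none fzero = count-empty (none ∘ fsuc)

count-pos : ∀ {n} {P : Fin n → Bool} x → P x ≡ true → 0 < count P
count-pos {P = P} fzero Px rewrite Px = s≤s z≤n
count-pos {P = P} (fsuc x) Px = ≤-trans (count-pos x Px) (m≤n+m _ (indicator (P fzero)))

count-pos⇒witness : ∀ {n} (P : Fin n → Bool) → 0 < count P → Σ (Fin n) λ x → P x ≡ true
count-pos⇒witness {suc n} P pos with P fzero in P0
... | true = fzero , P0
... | false with count-pos⇒witness (P ∘ fsuc) pos
...   | x , Px = fsuc x , Px

count≡0⇒false : ∀ {n} (P : Fin n → Bool) → count P ≡ 0 → ∀ x → P x ≡ false
count≡0⇒false P count≡0 x with P x in Px
... | false = refl
... | true = ⊥-elim (<⇒≢ (count-pos x Px) (sym count≡0))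

count-∪-∩ : ∀ {n} (P Q : Fin n → Bool) →
  count (P ∪ Q) + count (P ∩ Q) ≡ count P + count Q
count-∪-∩ {n} P Q = begin
  count (P ∪ Q) + count (P ∩ Q) ≡⟨ ∑-distrib-+ {n} _ _ ⟨
  sum {n} (λ x → indicator (P x ∨ Q x) + indicator (P x ∧ Q x)) ≡⟨ sum-cong-≗ (λ x → pointwise (P x) (Q x)) ⟩
  sum {n} (λ x → indicator (P x) + indicator (Q x)) ≡⟨ ∑-distrib-+ {n} _ _ ⟩
  count P + count Q ∎
  where
  open ≡-Reasoning
  pointwise : ∀ a b → indicator (a ∨ b) + indicator (a ∧ b) ≡ indicator a + indicator b
  pointwise true true = refl
  pointwise true false = refl
  pointwise false true = refl
  pointwise false false = refl

count-∪≤ : ∀ {n} (P Q : Fin n → Bool) → count (P ∪ Q) ≤ count P + count Q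
count-∪≤ P Q = ≤-trans (m≤m+n _ _) (≤-reflexive (count-∪-∩ P Q))

count-∪-disjoint : ∀ {n} (P Q : Fin n → Bool) → (∀ x → (P ∩ Q) x ≡ false) →
  count (P ∪ Q) ≡ count P + count Q
count-∪-disjoint P Q disjoint =
  trans (sym (trans (cong (count (P ∪ Q) +_) (count-empty disjoint)) (+-identityʳ _))) (count-∪-∩ P Q)

count-∖ : ∀ {n} (P Q : Fin n → Bool) → Q ⊆ P → count (P ∖ Q) + count Q ≡ count P
count-∖ P Q Q⊆P =
  trans (sym (count-∪-disjoint (P ∖ Q) Q disjoint)) (count-cong union)
  where
  disjoint : ∀ x → ((P ∖ Q) ∩ Q) x ≡ false
  disjoint x with Q x
  ... | true = trans (∧-identityʳ _) (∧-zeroʳ _)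
  ... | false = ∧-zeroʳ _
  union : ∀ x → ((P ∖ Q) ∪ Q) x ≡ P x
  union x with Q x in Qx
  ... | true = trans (∨-zeroʳ _) (sym (Q⊆P x Qx))
  ... | false = trans (∨-identityʳ _) (∧-identityʳ _)

∖-intro : ∀ {n} (P Q : Fin n → Bool) {x} → P x ≡ true → Q x ≡ false → (P ∖ Q) x ≡ true
∖-intro P Q Px Qx = ∧-intro Px (cong not Qx)

∖⇒∈ : ∀ {n} (P Q : Fin n → Bool) {x} → (P ∖ Q) x ≡ true → P x ≡ true
∖⇒∈ P Q = ∧-conicalˡ _ _

∖⇒∉ : ∀ {n} (P Q : Fin n → Bool) {x} → (P ∖ Q) x ≡ true → Q x ≡ false
∖⇒∉ P Q {x} x∈ = trans (sym (not-involutive (Q x))) (cong not (∧-conicalʳ (P x) _ x∈))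

x∈⁅x⁆ : ∀ {n} (x : Fin n) → ⁅ x ⁆ x ≡ true
x∈⁅x⁆ x = dec-true (x ≟ᶠ x) refl

∈⁅⁆⇒≡ : ∀ {n} {x y : Fin n} → ⁅ y ⁆ x ≡ true → x ≡ y
∈⁅⁆⇒≡ {x = x} {y} x∈ with x ≟ᶠ y
... | yes x≡y = x≡y

⁅⁆⊆ : ∀ {n} {P : Fin n → Bool} {x} → P x ≡ true → ⁅ x ⁆ ⊆ P
⁅⁆⊆ {P = P} Px y y∈ = subst (λ z → P z ≡ true) (sym (∈⁅⁆⇒≡ y∈)) Px

count-⁅⁆ : ∀ {n} (x : Fin n) → count ⁅ x ⁆ ≡ 1
count-⁅⁆ {suc n} fzero = cong suc (count-empty {n} (λ _ → refl))
count-⁅⁆ (fsuc x) = count-⁅⁆ x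

count-∖< : ∀ {n} (P Q : Fin n → Bool) → Q ⊆ P → 0 < count Q → count (P ∖ Q) < count P
count-∖< P Q Q⊆P 0<|Q| = subst (count (P ∖ Q) <_) (count-∖ P Q Q⊆P) (m<m+n _ 0<|Q|)

count-∖⁅⁆ : ∀ {n} (P : Fin n → Bool) {x} → P x ≡ true → count (P ∖ ⁅ x ⁆) < count P
count-∖⁅⁆ P {x} Px = count-∖< P ⁅ x ⁆ (⁅⁆⊆ Px) (≤-reflexive (sym (count-⁅⁆ x)))

exists : ∀ {n} → (Fin n → Bool) → Bool
exists {zero} P = false
exists {suc n} P = P fzero ∨ exists (P ∘ fsuc)

exists-intro : ∀ {n} (P : Fin n → Bool) x → P x ≡ true → exists P ≡ true
exists-intro P fzero Px = ∨-introˡ _ Px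
exists-intro P (fsuc x) Px = ∨-introʳ (P fzero) (exists-intro (P ∘ fsuc) x Px)

exists-elim : ∀ {n} (P : Fin n → Bool) → exists P ≡ true → Σ (Fin n) λ x → P x ≡ true
exists-elim {suc n} P ∃P with ∨-elim {P fzero} ∃P
... | inj₁ P0 = fzero , P0
... | inj₂ ∃P′ with exists-elim (P ∘ fsuc) ∃P′
...   | x , Px = fsuc x , Px

-- Hall's theorem

module Hall {n} (E : Fin n → Fin n → Bool) where

  nbhd : (R S : Fin n → Bool) → Fin n → Bool
  nbhd R S y = R y ∧ exists (λ x → S x ∧ E x y)

  HallCondition : (L R : Fin n → Bool) → Set
  HallCondition L R = ∀ S → S ⊆ L → count S ≤ count (nbhd R S)

  record Matching (L R : Fin n → Bool) : Set where
    field
      mate           : Fin n → Fin n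
      mate-∈         : ∀ x → L x ≡ true → R (mate x) ≡ true
      mate-edge      : ∀ x → L x ≡ true → E x (mate x) ≡ true
      mate-injective : ∀ x y → L x ≡ true → L y ≡ true → mate x ≡ mate y → x ≡ y

  nbhd⊆ : ∀ R S → nbhd R S ⊆ R
  nbhd⊆ R S y = ∧-conicalˡ _ _

  nbhd-intro : ∀ R S {x y} → R y ≡ true → S x ≡ true → E x y ≡ true → nbhd R S y ≡ true
  nbhd-intro R S {x} {y} Ry Sx Exy = ∧-intro Ry (exists-intro (λ x → S x ∧ E x y) x (∧-intro Sx Exy))

  nbhd-mono : ∀ R {R′} S {S′} → R ⊆ R′ → S ⊆ S′ → nbhd R S ⊆ nbhd R′ S′
  nbhd-mono R {R′} S {S′} R⊆R′ S⊆S′ y y∈ =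
    let x , Sx∧Exy = exists-elim _ (∧-conicalʳ (R y) _ y∈) in
    nbhd-intro R′ S′ (R⊆R′ y (∧-conicalˡ _ _ y∈)) (S⊆S′ x (∧-conicalˡ _ _ Sx∧Exy)) (∧-conicalʳ (S x) _ Sx∧Exy)

  nbhd-within : ∀ R S T → T ⊆ S → nbhd R T ⊆ nbhd (nbhd R S) T
  nbhd-within R S T T⊆S y y∈ = ∧-intro (nbhd-mono R T (λ _ Ry → Ry) T⊆S y y∈) (∧-conicalʳ (R y) _ y∈)

  nbhd-∪-∖ : ∀ R S T Q → nbhd R S ⊆ Q → nbhd R (S ∪ T) ⊆ Q ∪ nbhd (R ∖ Q) T
  nbhd-∪-∖ R S T Q NS⊆Q y y∈ = ∨-by-cases (Q y) λ Qy → case ∨-elim (∧-conicalˡ _ _ x∈∧Exy) of λ where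
      (inj₁ Sx) → case trans (sym (NS⊆Q y (nbhd-intro R S Ry Sx Exy))) Qy of λ ()
      (inj₂ Tx) → nbhd-intro (R ∖ Q) T (∧-intro Ry (cong not Qy)) Tx Exy
    where
    Ry = ∧-conicalˡ _ _ y∈
    witness = exists-elim _ (∧-conicalʳ (R y) _ y∈)
    x = proj₁ witness
    x∈∧Exy = proj₂ witness
    Exy = ∧-conicalʳ (S x ∨ T x) _ x∈∧Exy

  empty-matching : ∀ {L} R → (∀ x → L x ≡ false) → Matching L R
  empty-matching {L} R none = record
    { mate = λ x → x ; mate-∈ = λ x → absurd x ; mate-edge = λ x → absurd x ; mate-injective = λ x _ → absurd x }
    where
    absurd : ∀ {A : Set} x → L x ≡ true → A
    absurd x Lx = case trans (sym Lx) (none x) of λ ()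

  singleton-matching : ∀ {x₀ y₀} → E x₀ y₀ ≡ true → Matching ⁅ x₀ ⁆ ⁅ y₀ ⁆
  singleton-matching {x₀} {y₀} Ex₀y₀ = record
    { mate = λ _ → y₀
    ; mate-∈ = λ _ _ → x∈⁅x⁆ y₀
    ; mate-edge = λ x x∈ → subst (λ z → E z y₀ ≡ true) (sym (∈⁅⁆⇒≡ x∈)) Ex₀y₀
    ; mate-injective = λ x y x∈ y∈ _ → trans (∈⁅⁆⇒≡ x∈) (sym (∈⁅⁆⇒≡ y∈))
    }

  merge-matchings : ∀ {L R} S {R₁} → R₁ ⊆ R → Matching S R₁ → Matching (L ∖ S) (R ∖ R₁) → Matching L R
  merge-matchings {L} {R} S {R₁} R₁⊆R M₁ M₂ = record
    { mate = mate ; mate-∈ = mate-∈ ; mate-edge = mate-edge ; mate-injective = mate-injective }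
    where
    module M₁ = Matching M₁
    module M₂ = Matching M₂
    mate : Fin n → Fin n
    mate x = if S x then M₁.mate x else M₂.mate x
    mate-∈ : ∀ x → L x ≡ true → R (mate x) ≡ true
    mate-∈ x Lx with S x in Sx
    ... | true = R₁⊆R _ (M₁.mate-∈ x Sx)
    ... | false = ∖⇒∈ R R₁ (M₂.mate-∈ x (∖-intro L S Lx Sx))
    mate-edge : ∀ x → L x ≡ true → E x (mate x) ≡ true
    mate-edge x Lx with S x in Sx
    ... | true = M₁.mate-edge x Sx
    ... | false = M₂.mate-edge x (∖-intro L S Lx Sx)
    apart : ∀ x y → S x ≡ true → (L ∖ S) y ≡ true → M₁.mate x ≢ M₂.mate y
    apart x y Sx y∈ eq =
      case trans (sym (M₁.mate-∈ x Sx)) (subst (λ z → R₁ z ≡ false) (sym eq) (∖⇒∉ R R₁ (M₂.mate-∈ y y∈))) of λ ()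
    mate-injective : ∀ x y → L x ≡ true → L y ≡ true → mate x ≡ mate y → x ≡ y
    mate-injective x y Lx Ly eq with S x in Sx | S y in Sy
    ... | true | true = M₁.mate-injective x y Sx Sy eq
    ... | false | false = M₂.mate-injective x y (∖-intro L S Lx Sx) (∖-intro L S Ly Sy) eq
    ... | true | false = ⊥-elim (apart x y Sx (∖-intro L S Ly Sy) eq)
    ... | false | true = ⊥-elim (apart y x Sy (∖-intro L S Lx Sx) (sym eq))

  Critical : (L R S : Fin n → Bool) → Set
  Critical L R S = S ⊆ L × 0 < count S × count S < count L × count (nbhd R S) ≤ count S

  critical-cong : ∀ {L R S S′} → (∀ x → S x ≡ S′ x) → Critical L R S → Critical L R S′
  critical-cong {L} {R} {S} {S′} S≗S′ (S⊆L , nonempty , smaller , tight) =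
    (λ x S′x → S⊆L x (trans (S≗S′ x) S′x)) ,
    subst (0 <_) |S|≡|S′| nonempty ,
    subst (_< count L) |S|≡|S′| smaller ,
    subst₂ _≤_ |NS|≡|NS′| |S|≡|S′| tight
    where
    |S|≡|S′| = count-cong S≗S′
    |NS|≡|NS′| = ≤-antisym (count-mono (nbhd-mono R S (λ _ Ry → Ry) (λ x Sx → trans (sym (S≗S′ x)) Sx)))
                           (count-mono (nbhd-mono R S′ (λ _ Ry → Ry) (λ x S′x → trans (S≗S′ x) S′x)))

  critical? : ∀ L R → Dec (Σ _ (Critical L R))
  critical? L R = map′
    (λ (V , critical) → lookup V , critical)
    (λ (S , critical) → tabulate S , critical-cong (λ x → sym (lookup∘tabulate S x)) critical)
    (anySubset? λ V → ⊆? (lookup V) ×-dec 0 <? count (lookup V) ×-dec count (lookup V) <? count L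
                        ×-dec count (nbhd R (lookup V)) ≤? count (lookup V))
    where
    ⊆? : ∀ S → Dec (S ⊆ L)
    ⊆? S = all? λ x → (S x Bool.≟ true) →-dec (L x Bool.≟ true)

  hall-inside : ∀ L R S → S ⊆ L → HallCondition L R → HallCondition S (nbhd R S)
  hall-inside L R S S⊆L hallL T T⊆S =
    ≤-trans (hallL T (λ x Tx → S⊆L x (T⊆S x Tx))) (count-mono (nbhd-within R S T T⊆S))

  hall-outside : ∀ L R S → Critical L R S → HallCondition L R → HallCondition (L ∖ S) (R ∖ nbhd R S)
  hall-outside L R S (S⊆L , _ , _ , tight) hallL T T⊆L∖S = +-cancelˡ-≤ (count S) _ _ (begin
    count S + count T                   ≡⟨ count-∪-disjoint S T disjoint ⟨
    count (S ∪ T)                       ≤⟨ hallL (S ∪ T) S∪T⊆L ⟩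
    count (nbhd R (S ∪ T))              ≤⟨ count-mono (nbhd-∪-∖ R S T NS (λ _ y∈ → y∈)) ⟩
    count (NS ∪ nbhd (R ∖ NS) T)        ≤⟨ count-∪≤ NS _ ⟩
    count NS + count (nbhd (R ∖ NS) T)  ≤⟨ +-monoˡ-≤ _ tight ⟩
    count S + count (nbhd (R ∖ NS) T)   ∎)
    where
    open ≤-Reasoning
    NS = nbhd R S
    disjoint : ∀ x → (S ∩ T) x ≡ false
    disjoint x = ∧-≡false (S x) λ Tx → ∖⇒∉ L S (T⊆L∖S x Tx)
    S∪T⊆L : S ∪ T ⊆ L
    S∪T⊆L x x∈ with ∨-elim {S x} x∈
    ... | inj₁ Sx = S⊆L x Sx
    ... | inj₂ Tx = ∖⇒∈ L S (T⊆L∖S x Tx)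

  hall-without-edge : ∀ L R {x₀} y₀ → ¬ Σ _ (Critical L R) → L x₀ ≡ true → HallCondition (L ∖ ⁅ x₀ ⁆) (R ∖ ⁅ y₀ ⁆)
  hall-without-edge L R {x₀} y₀ noCritical Lx₀ T T⊆L′ with 0 <? count T
  ... | no empty = ≤-trans (≮⇒≥ empty) z≤n
  ... | yes nonempty = +-cancelˡ-≤ 1 _ _ (begin
    suc (count T)                               ≤⟨ ≰⇒> (λ tight → noCritical (T , T⊆L , nonempty , smaller , tight)) ⟩
    count (nbhd R T)                            ≤⟨ count-mono (nbhd-∪-∖ R (λ _ → false) T ⁅ y₀ ⁆ nbhd-∅) ⟩
    count (⁅ y₀ ⁆ ∪ nbhd (R ∖ ⁅ y₀ ⁆) T)        ≤⟨ count-∪≤ ⁅ y₀ ⁆ _ ⟩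
    count ⁅ y₀ ⁆ + count (nbhd (R ∖ ⁅ y₀ ⁆) T)  ≡⟨ cong (_+ count (nbhd (R ∖ ⁅ y₀ ⁆) T)) (count-⁅⁆ y₀) ⟩
    1 + count (nbhd (R ∖ ⁅ y₀ ⁆) T)             ∎)
    where
    open ≤-Reasoning
    T⊆L : T ⊆ L
    T⊆L x Tx = ∖⇒∈ L ⁅ x₀ ⁆ (T⊆L′ x Tx)
    smaller : count T < count L
    smaller = ≤-<-trans (count-mono T⊆L′) (count-∖⁅⁆ L Lx₀)
    nbhd-∅ : nbhd R (λ _ → false) ⊆ ⁅ y₀ ⁆
    nbhd-∅ y y∈ with exists-elim {n} (λ _ → false) (∧-conicalʳ (R y) _ y∈)
    ... | _ , ()

  hall-neighbour : ∀ L R {x₀} → HallCondition L R → L x₀ ≡ true → Σ _ λ y₀ → R y₀ ≡ true × E x₀ y₀ ≡ true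
  hall-neighbour L R {x₀} hallL Lx₀ =
    let y₀ , y₀∈ = count-pos⇒witness _ (≤-trans (≤-reflexive (sym (count-⁅⁆ x₀))) (hallL ⁅ x₀ ⁆ (⁅⁆⊆ Lx₀)))
        x , x∈∧Exy₀ = exists-elim _ (∧-conicalʳ (R y₀) _ y₀∈)
    in y₀ , nbhd⊆ R ⁅ x₀ ⁆ y₀ y₀∈ ,
       subst (λ z → E z y₀ ≡ true) (∈⁅⁆⇒≡ (∧-conicalˡ _ _ x∈∧Exy₀)) (∧-conicalʳ (⁅ x₀ ⁆ x) _ x∈∧Exy₀)

  HallBelow : ℕ → Set
  HallBelow c = ∀ L R → count L < c → HallCondition L R → Matching L R

  -- Either a critical set splits the problem into two smaller ones, or any edge at a vertex x₀ can be
  -- used and the rest of L matched by induction.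
  hall-step : ∀ L R → HallBelow (count L) → HallCondition L R → Matching L R
  hall-step L R hall< hallL with critical? L R | 0 <? count L
  ... | yes (S , critical@(S⊆L , _ , smaller , _)) | _ =
    merge-matchings S (nbhd⊆ R S)
      (hall< S (nbhd R S) smaller (hall-inside L R S S⊆L hallL))
      (hall< (L ∖ S) (R ∖ nbhd R S) (count-∖< L S S⊆L (proj₁ (proj₂ critical))) (hall-outside L R S critical hallL))
  ... | no noCritical | yes nonempty =
    let x₀ , Lx₀ = count-pos⇒witness L nonempty
        y₀ , Ry₀ , Ex₀y₀ = hall-neighbour L R hallL Lx₀
    in merge-matchings ⁅ x₀ ⁆ (⁅⁆⊆ Ry₀) (singleton-matching Ex₀y₀)
         (hall< (L ∖ ⁅ x₀ ⁆) (R ∖ ⁅ y₀ ⁆) (count-∖⁅⁆ L Lx₀) (hall-without-edge L R y₀ noCritical Lx₀))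
  ... | no _ | no empty = empty-matching R (count≡0⇒false L (n≤0⇒n≡0 (≮⇒≥ empty)))

  hall-below : ∀ c → HallBelow c
  hall-below (suc c) L R (s≤s |L|≤c) = hall-step L R λ L′ R′ smaller → hall-below c L′ R′ (<-≤-trans smaller |L|≤c)

  hall : ∀ L R → HallCondition L R → Matching L R
  hall L R = hall-below (suc (count L)) L R ≤-refl

-- Expansion in biregular graphs

deg : ∀ {n} → Graph n → Fin n → (Fin n → Bool) → ℕ
deg G x Q = count (λ y → adj G x y ∧ Q y)

edges : ∀ {n} → Graph n → (Fin n → Bool) → (Fin n → Bool) → ℕ
edges G P Q = sum λ x → count λ y → P x ∧ adj G x y ∧ Q y

edges-comm : ∀ {n} (G : Graph n) P Q → edges G P Q ≡ edges G Q P
edges-comm {n} G P Q = trans (∑-comm {n} {n} _) (sum-cong-≗ λ y → count-cong λ x → flip (P x) (adj G x y) (Q y) (adj-sym G x y))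
  where
  flip : ∀ a b {b′} c → b ≡ b′ → a ∧ b ∧ c ≡ c ∧ b′ ∧ a
  flip true b true refl = refl
  flip true b false refl = ∧-zeroʳ b
  flip false b true refl = sym (∧-zeroʳ b)
  flip false b false refl = refl

edges-regular : ∀ {n} (G : Graph n) P Q {d} → (∀ x → P x ≡ true → deg G x Q ≡ d) → edges G P Q ≡ count P * d
edges-regular {n} G P Q {d} regular = begin
  edges G P Q                          ≡⟨ sum-cong-≗ row ⟩
  sum (λ x → indicator (P x) * d)      ≡⟨ *-distribʳ-sum d (indicator ∘ P) ⟨
  count P * d                          ∎
  where
  open ≡-Reasoning
  row : ∀ x → count (λ y → P x ∧ adj G x y ∧ Q y) ≡ indicator (P x) * d
  row x with P x in Px
  ... | true = trans (regular x Px) (sym (+-identityʳ d))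
  ... | false = count-empty {n} λ _ → refl

edges-mono : ∀ {n} (G : Graph n) {P Q P′ Q′} →
  (∀ x y → (P x ∧ adj G x y ∧ Q y) ≡ true → (P′ x ∧ adj G x y ∧ Q′ y) ≡ true) → edges G P Q ≤ edges G P′ Q′
edges-mono G P⇒P′ = sum-mono λ x → count-mono (P⇒P′ x)

record NonEmptyBiregular {n} (G : Graph n) (A B : Fin n → Bool) : Set where
  field
    d₁ d₂ : ℕ
    deg-A : ∀ x → A x ≡ true → deg G x B ≡ d₁
    deg-B : ∀ y → B y ≡ true → deg G y A ≡ d₂
    edge  : Σ _ λ x → Σ _ λ y → A x ≡ true × B y ≡ true × adj G x y ≡ true

  0<d₂ : 0 < d₂
  0<d₂ = let x , y , Ax , By , Exy = edge in
    subst (0 <_) (deg-B y By) (count-pos x (∧-intro (trans (adj-sym G y x) Exy) Ax))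

  expansion : ∀ S → S ⊆ A → count S * count B ≤ count (Hall.nbhd (adj G) B S) * count A
  expansion S S⊆A = *-cancelʳ-≤ _ _ d₂ {{>-nonZero 0<d₂}} (begin
    count S * count B * d₂    ≡⟨ *-assoc (count S) _ _ ⟩
    count S * (count B * d₂)  ≡⟨ cong (count S *_) |B|d₂≡|A|d₁ ⟩
    count S * (count A * d₁)  ≡⟨ x∙yz≈y∙xz (count S) (count A) d₁ ⟩
    count A * (count S * d₁)  ≤⟨ *-monoʳ-≤ (count A) |S|d₁≤|NS|d₂ ⟩
    count A * (count NS * d₂) ≡⟨ x∙yz≈yx∙z (count A) (count NS) d₂ ⟩
    count NS * count A * d₂   ∎)
    where
    open ≤-Reasoning
    NS = Hall.nbhd (adj G) B S
    |B|d₂≡|A|d₁ : count B * d₂ ≡ count A * d₁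
    |B|d₂≡|A|d₁ = sym (trans (sym (edges-regular G A B deg-A)) (trans (edges-comm G A B) (edges-regular G B A deg-B)))
    towards-NS : ∀ x y → (S x ∧ adj G x y ∧ B y) ≡ true → (A x ∧ adj G x y ∧ NS y) ≡ true
    towards-NS x y x∈∧Exy∧y∈ = ∧-intro (S⊆A x Sx) (∧-intro Exy (Hall.nbhd-intro (adj G) B S By Sx Exy))
      where
      Sx = ∧-conicalˡ _ _ x∈∧Exy∧y∈
      Exy = ∧-conicalˡ _ _ (∧-conicalʳ (S x) _ x∈∧Exy∧y∈)
      By = ∧-conicalʳ (adj G x y) _ (∧-conicalʳ (S x) _ x∈∧Exy∧y∈)
    |S|d₁≤|NS|d₂ : count S * d₁ ≤ count NS * d₂
    |S|d₁≤|NS|d₂ = begin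
      count S * d₁     ≡⟨ edges-regular G S B (λ x Sx → deg-A x (S⊆A x Sx)) ⟨
      edges G S B      ≤⟨ edges-mono G {S} {B} {A} {NS} towards-NS ⟩
      edges G A NS     ≡⟨ edges-comm G A NS ⟩
      edges G NS A     ≡⟨ edges-regular G NS A (λ y y∈ → deg-B y (∧-conicalˡ _ _ y∈)) ⟩
      count NS * d₂    ∎

NonEmptyBiregular-sym : ∀ {n} {G : Graph n} {A B} → NonEmptyBiregular G A B → NonEmptyBiregular G B A
NonEmptyBiregular-sym {G = G} H = record
  { d₁ = d₂ ; d₂ = d₁ ; deg-A = deg-B ; deg-B = deg-A
  ; edge = let x , y , Ax , By , Exy = edge in y , x , By , Ax , trans (adj-sym G y x) Exy }
  where open NonEmptyBiregular H

-- Layered graphs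

sumBelow : ℕ → (ℕ → ℕ) → ℕ
sumBelow zero f = 0
sumBelow (suc r) f = sumBelow r f + f r

-- With a′ = k + e, the bounds k · (s · a′) ≤ k · (u · a) and e · (a · s′) ≤ e · (a · u) add up to a · a′ · u.
ratio-step : ∀ a k e {Σs Σu s s′ u} → 0 < a → s * (k + e) ≤ u * a → s′ ≤ u →
  a * Σs + a * s ≤ a * Σu + k * s →
  (k + e) * (Σs + s) + (k + e) * s′ ≤ (k + e) * (Σu + u) + k * s′
ratio-step a k e {Σs} {Σu} {s} {s′} {u} 0<a sa′≤ua s′≤u ih = *-cancelˡ-≤ a {{>-nonZero 0<a}} (begin
  a * ((k + e) * (Σs + s) + (k + e) * s′)                      ≡⟨ expand₁ a k e Σs s s′ ⟩
  (k + e) * (a * Σs + a * s) + a * (k + e) * s′                ≤⟨ +-monoˡ-≤ (a * (k + e) * s′) (*-monoʳ-≤ (k + e) ih) ⟩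
  (k + e) * (a * Σu + k * s) + a * (k + e) * s′                ≡⟨ expand₂ a k e Σu s s′ ⟩
  (k + e) * a * Σu + a * k * s′ + (k * (s * (k + e)) + e * (a * s′))
      ≤⟨ +-monoʳ-≤ ((k + e) * a * Σu + a * k * s′) (+-mono-≤ (*-monoʳ-≤ k sa′≤ua) (*-monoʳ-≤ e (*-monoʳ-≤ a s′≤u))) ⟩
  (k + e) * a * Σu + a * k * s′ + (k * (u * a) + e * (a * u)) ≡⟨ expand₃ a k e Σu u s′ ⟩
  a * ((k + e) * (Σu + u) + k * s′)                            ∎)
  where
  open ≤-Reasoning
  expand₁ : ∀ a k e Σs s s′ → a * ((k + e) * (Σs + s) + (k + e) * s′) ≡ (k + e) * (a * Σs + a * s) + a * (k + e) * s′
  expand₁ = solve-∀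
  expand₂ : ∀ a k e Σu s s′ → (k + e) * (a * Σu + k * s) + a * (k + e) * s′
                              ≡ (k + e) * a * Σu + a * k * s′ + (k * (s * (k + e)) + e * (a * s′))
  expand₂ = solve-∀
  expand₃ : ∀ a k e Σu u s′ → (k + e) * a * Σu + a * k * s′ + (k * (u * a) + e * (a * u)) ≡ a * ((k + e) * (Σu + u) + k * s′)
  expand₃ = solve-∀

sumBelow-≤-by-ratios : ∀ (a s u : ℕ → ℕ) r → (∀ i → i < r → 0 < a i) → (∀ i → i ≤ r → a 0 ≤ a i) →
  (∀ i → i < r → s i * a (suc i) ≤ u i * a i) → (∀ i → i < r → s (suc i) ≤ u i) → s r ≡ 0 →
  sumBelow r s ≤ sumBelow r u
sumBelow-≤-by-ratios a s u zero _ _ _ _ _ = z≤n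
sumBelow-≤-by-ratios a s u r@(suc _) 0<a a₀≤ ratio shift s-last≡0 =
  *-cancelˡ-≤ (a r) {{>-nonZero (<-≤-trans (0<a 0 z<s) (a₀≤ r ≤-refl))}} (begin
    a r * sumBelow r s              ≤⟨ m≤m+n _ _ ⟩
    a r * sumBelow r s + a r * s r  ≤⟨ invariant r ≤-refl ⟩
    a r * sumBelow r u + a 0 * s r  ≡⟨ cong (λ t → a r * sumBelow r u + a 0 * t) s-last≡0 ⟩
    a r * sumBelow r u + a 0 * 0    ≡⟨ cong (a r * sumBelow r u +_) (*-zeroʳ (a 0)) ⟩
    a r * sumBelow r u + 0          ≡⟨ +-identityʳ _ ⟩
    a r * sumBelow r u              ∎)
  where
  open ≤-Reasoning
  -- With k = a 0 this is  Σ_{i<j} s i + (1 - k / a j) · s j ≤ Σ_{i<j} u i,  scaled by a j.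
  invariant : ∀ j → j ≤ r → a j * sumBelow j s + a j * s j ≤ a j * sumBelow j u + a 0 * s j
  invariant zero _ = ≤-refl
  invariant (suc j) j<r with m≤n⇒∃[o]m+o≡n (a₀≤ (suc j) j<r)
  ... | e , a₀+e≡a′ = subst (λ a′ → a′ * (sumBelow j s + s j) + a′ * s (suc j) ≤ a′ * (sumBelow j u + u j) + a 0 * s (suc j))
      a₀+e≡a′
      (ratio-step (a j) (a 0) e (0<a j j<r)
        (subst (λ a′ → s j * a′ ≤ u j * a j) (sym a₀+e≡a′) (ratio j j<r)) (shift j j<r) (invariant j (<⇒≤ j<r)))

anyBelow : ℕ → (ℕ → Bool) → Bool
anyBelow zero b = false
anyBelow (suc r) b = anyBelow r b ∨ b r

anyBelow-intro : ∀ {r} (b : ℕ → Bool) i → i < r → b i ≡ true → anyBelow r b ≡ true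
anyBelow-intro {suc r} b i i<1+r bi with m≤n⇒m<n∨m≡n (≤-pred i<1+r)
... | inj₁ i<r = ∨-introˡ (b r) (anyBelow-intro b i i<r bi)
... | inj₂ refl = ∨-introʳ (anyBelow r b) bi

anyBelow-elim : ∀ r (b : ℕ → Bool) → anyBelow r b ≡ true → Σ ℕ λ i → i < r × b i ≡ true
anyBelow-elim (suc r) b any with ∨-elim {anyBelow r b} any
... | inj₁ any′ = let i , i<r , bi = anyBelow-elim r b any′ in i , m<n⇒m<1+n i<r , bi
... | inj₂ br = r , ≤-refl , br

layersBelow : ∀ {n} → (ℕ → Fin n → Bool) → ℕ → Fin n → Bool
layersBelow Y r x = anyBelow r λ i → Y i x

LayersDisjoint : ∀ {n} → (ℕ → Fin n → Bool) → ℕ → Set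
LayersDisjoint Y r = ∀ i j → i ≤ r → j ≤ r → i ≢ j → ∀ x → Y i x ≡ true → Y j x ≡ false

count-layersBelow : ∀ {n} (Y : ℕ → Fin n → Bool) (P : Fin n → Bool) r →
  (∀ i j → i < j → j < r → ∀ x → Y i x ≡ true → Y j x ≡ false) →
  count (P ∩ layersBelow Y r) ≡ sumBelow r λ i → count (P ∩ Y i)
count-layersBelow Y P zero _ = count-empty λ x → ∧-zeroʳ (P x)
count-layersBelow Y P (suc r) disjoint = begin
  count (P ∩ layersBelow Y (suc r))                   ≡⟨ count-cong (λ x → ∧-distribˡ-∨ (P x) _ _) ⟩
  count ((P ∩ layersBelow Y r) ∪ (P ∩ Y r))           ≡⟨ count-∪-disjoint _ _ apart ⟩
  count (P ∩ layersBelow Y r) + count (P ∩ Y r)       ≡⟨ cong (_+ count (P ∩ Y r)) (count-layersBelow Y P r disjoint′) ⟩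
  sumBelow r (λ i → count (P ∩ Y i)) + count (P ∩ Y r) ∎
  where
  open ≡-Reasoning
  disjoint′ : ∀ i j → i < j → j < r → ∀ x → Y i x ≡ true → Y j x ≡ false
  disjoint′ i j i<j j<r = disjoint i j i<j (m<n⇒m<1+n j<r)
  apart : ∀ x → ((P ∩ layersBelow Y r) ∩ (P ∩ Y r)) x ≡ false
  apart x = ∧-≡false (P x ∧ layersBelow Y r x) λ Px∧Yrx →
    ∧-≡false (P x) λ below →
      let i , i<r , Yix = anyBelow-elim r _ below in
      case trans (sym (∧-conicalʳ (P x) _ Px∧Yrx)) (disjoint i r i<r ≤-refl x Yix) of λ ()

record DisjointPaths {n} (G : Graph n) (Y : ℕ → Fin n → Bool) (r k : ℕ) : Set where
  field
    path           : ℕ → Fin k → Fin n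
    path-∈         : ∀ t → t ≤ r → ∀ j → Y t (path t j) ≡ true
    path-edge      : ∀ t → t < r → ∀ j → adj G (path t j) (path (suc t) j) ≡ true
    path-injective : ∀ t → t ≤ r → ∀ j j′ → path t j ≡ path t j′ → j ≡ j′

module LayeredPaths {n} (G : Graph n) (Y : ℕ → Fin n → Bool) (r : ℕ) (disjoint : LayersDisjoint Y r)
  (biregular : ∀ i → i < r → NonEmptyBiregular G (Y i) (Y (suc i)))
  (first-smallest : ∀ i → i ≤ r → count (Y 0) ≤ count (Y i)) where

  L R : Fin n → Bool
  L = layersBelow Y r
  R = layersBelow (Y ∘ suc) r

  E : Fin n → Fin n → Bool
  E x y = ⁅ x ⁆ y ∨ (adj G x y ∧ anyBelow r λ i → Y i x ∧ Y (suc i) y)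

  open Hall E

  same-layer : ∀ {i j x} → i ≤ r → j ≤ r → Y i x ≡ true → Y j x ≡ true → i ≡ j
  same-layer {i} {j} {x} i≤r j≤r Yix Yjx with i ≟ j
  ... | yes i≡j = i≡j
  ... | no i≢j = case trans (sym Yjx) (disjoint i j i≤r j≤r i≢j x Yix) of λ ()

  lower-layers-disjoint : ∀ i j → i < j → j < r → ∀ x → Y i x ≡ true → Y j x ≡ false
  lower-layers-disjoint i j i<j j<r = disjoint i j (<⇒≤ (<-trans i<j j<r)) (<⇒≤ j<r) (<⇒≢ i<j)

  upper-layers-disjoint : ∀ i j → i < j → j < r → ∀ x → Y (suc i) x ≡ true → Y (suc j) x ≡ false
  upper-layers-disjoint i j i<j j<r = disjoint (suc i) (suc j) (<⇒≤ (≤-<-trans i<j j<r)) j<r (<⇒≢ (s<s i<j))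

  layer-nonempty : ∀ i → i < r → 0 < count (Y i)
  layer-nonempty i i<r = let x , _ , Yix , _ = NonEmptyBiregular.edge (biregular i i<r) in count-pos x Yix

  hall-condition : HallCondition L R
  hall-condition S S⊆L = begin
    count S        ≡⟨ count-cong S≡S∩L ⟩
    count (S ∩ L)  ≡⟨ count-layersBelow Y S r lower-layers-disjoint ⟩
    sumBelow r s   ≤⟨ sumBelow-≤-by-ratios a s u r layer-nonempty first-smallest ratio shift s-last≡0 ⟩
    sumBelow r u   ≡⟨ count-layersBelow (Y ∘ suc) NS r upper-layers-disjoint ⟨
    count (NS ∩ R) ≤⟨ count-mono {P = NS ∩ R} (λ y → ∧-conicalˡ _ _) ⟩
    count NS       ∎
    where
    open ≤-Reasoning
    NS = nbhd R S
    a s u : ℕ → ℕ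
    a i = count (Y i)
    s i = count (S ∩ Y i)
    u i = count (NS ∩ Y (suc i))
    S≡S∩L : ∀ x → S x ≡ (S ∩ L) x
    S≡S∩L x with S x in Sx
    ... | false = refl
    ... | true = sym (S⊆L x Sx)
    ratio : ∀ i → i < r → s i * a (suc i) ≤ u i * a i
    ratio i i<r = ≤-trans (NonEmptyBiregular.expansion (biregular i i<r) (S ∩ Y i) (λ x → ∧-conicalʳ (S x) _))
                          (*-monoˡ-≤ (a i) (count-mono forward))
      where
      forward : Hall.nbhd (adj G) (Y (suc i)) (S ∩ Y i) ⊆ NS ∩ Y (suc i)
      forward y y∈ =
        let x , x∈∧Exy = exists-elim _ (∧-conicalʳ (Y (suc i) y) _ y∈)
            Yi+1y = ∧-conicalˡ _ _ y∈
            Sx∧Yix = ∧-conicalˡ _ _ x∈∧Exy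
            Yix = ∧-conicalʳ (S x) _ Sx∧Yix
            Exy = ∧-conicalʳ (S x ∧ Y i x) _ x∈∧Exy
        in ∧-intro (nbhd-intro R S (anyBelow-intro _ i i<r Yi+1y) (∧-conicalˡ _ _ Sx∧Yix)
                      (∨-introʳ (⁅ x ⁆ y) (∧-intro Exy (anyBelow-intro _ i i<r (∧-intro Yix Yi+1y)))))
                   Yi+1y
    shift : ∀ i → i < r → s (suc i) ≤ u i
    shift i i<r = count-mono λ y y∈ →
      let Yi+1y = ∧-conicalʳ (S y) _ y∈ in
      ∧-intro (nbhd-intro R S (anyBelow-intro _ i i<r Yi+1y) (∧-conicalˡ _ _ y∈) (∨-introˡ _ (x∈⁅x⁆ y))) Yi+1y
    s-last≡0 : s r ≡ 0
    s-last≡0 = count-empty λ x → ∧-≡false (S x) (S-avoids-last x)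
      where
      S-avoids-last : ∀ x → Y r x ≡ true → S x ≡ false
      S-avoids-last x Yrx with S x in Sx
      ... | false = refl
      ... | true = let i , i<r , Yix = anyBelow-elim r _ (S⊆L x Sx) in
        case trans (sym Yrx) (disjoint i r (<⇒≤ i<r) ≤-refl (<⇒≢ i<r) x Yix) of λ ()

  open Matching (hall L R hall-condition)

  step : ∀ {t z} → t < r → Y t z ≡ true → mate z ≢ z → Y (suc t) (mate z) ≡ true × adj G z (mate z) ≡ true
  step {t} {z} t<r Ytz moved with ∨-elim {⁅ z ⁆ (mate z)} (mate-edge z (anyBelow-intro _ t t<r Ytz))
  ... | inj₁ fixed = ⊥-elim (moved (∈⁅⁆⇒≡ fixed))
  ... | inj₂ forward =
    let i , i<r , Yiz∧Yi+1 = anyBelow-elim r _ (∧-conicalʳ (adj G z (mate z)) _ forward)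
        i≡t = same-layer (<⇒≤ i<r) (<⇒≤ t<r) (∧-conicalˡ _ _ Yiz∧Yi+1) Ytz
    in subst (λ i → Y (suc i) (mate z) ≡ true) i≡t (∧-conicalʳ (Y i z) _ Yiz∧Yi+1) , ∧-conicalˡ _ _ forward

  -- A vertex of the first layer is not matched to itself, as it is not in R; a vertex of a later layer
  -- reached by the walk is not either, as it is already the mate of its predecessor.
  leaves-first-layer : ∀ {z} → 0 < r → Y 0 z ≡ true → mate z ≢ z
  leaves-first-layer {z} 0<r Y₀z fixed =
    let i , i<r , Yi+1 = anyBelow-elim r _ (mate-∈ z (anyBelow-intro _ 0 0<r Y₀z)) in
    case same-layer i<r z≤n (subst (λ z → Y (suc i) z ≡ true) fixed Yi+1) Y₀z of λ ()

  leaves-later-layer : ∀ {t z} → suc t < r → Y t z ≡ true → Y (suc t) (mate z) ≡ true → mate (mate z) ≢ mate z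
  leaves-later-layer {t} {z} t+1<r Ytz Yt+1 fixed =
    1+n≢n (same-layer (<⇒≤ t+1<r) (<⇒≤ t<r) Yt+1 (subst (λ y → Y t y ≡ true) (sym mate≡z) Ytz))
    where
    t<r = <-trans (n<1+n t) t+1<r
    mate≡z : mate z ≡ z
    mate≡z = mate-injective _ _ (anyBelow-intro _ (suc t) t+1<r Yt+1) (anyBelow-intro _ t t<r Ytz) fixed

  mutual
    walk-∈ : ∀ {x} → Y 0 x ≡ true → ∀ t → t ≤ r → Y t (fold x mate t) ≡ true
    walk-∈ x∈Y₀ zero _ = x∈Y₀
    walk-∈ x∈Y₀ (suc t) t<r = proj₁ (step t<r (walk-∈ x∈Y₀ t (<⇒≤ t<r)) (walk-moves x∈Y₀ t t<r))

    walk-moves : ∀ {x} → Y 0 x ≡ true → ∀ t → t < r → mate (fold x mate t) ≢ fold x mate t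
    walk-moves x∈Y₀ zero 0<r = leaves-first-layer 0<r x∈Y₀
    walk-moves x∈Y₀ (suc t) t+1<r =
      leaves-later-layer t+1<r (walk-∈ x∈Y₀ t (<⇒≤ (<-trans (n<1+n t) t+1<r))) (walk-∈ x∈Y₀ (suc t) (<⇒≤ t+1<r))

  walk-edge : ∀ {x} → Y 0 x ≡ true → ∀ t → t < r → adj G (fold x mate t) (fold x mate (suc t)) ≡ true
  walk-edge x∈Y₀ t t<r = proj₂ (step t<r (walk-∈ x∈Y₀ t (<⇒≤ t<r)) (walk-moves x∈Y₀ t t<r))

  walk-injective : ∀ {x x′} → Y 0 x ≡ true → Y 0 x′ ≡ true → ∀ t → t ≤ r → fold x mate t ≡ fold x′ mate t → x ≡ x′
  walk-injective _ _ zero _ eq = eq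
  walk-injective x∈Y₀ x′∈Y₀ (suc t) t<r eq = walk-injective x∈Y₀ x′∈Y₀ t (<⇒≤ t<r)
    (mate-injective _ _ (anyBelow-intro _ t t<r (walk-∈ x∈Y₀ t (<⇒≤ t<r))) (anyBelow-intro _ t t<r (walk-∈ x′∈Y₀ t (<⇒≤ t<r))) eq)

  paths : ∀ {k} (start : Fin k → Fin n) → (∀ j → Y 0 (start j) ≡ true) → (∀ j j′ → start j ≡ start j′ → j ≡ j′) →
    DisjointPaths G Y r k
  paths start start-∈ start-injective = record
    { path = λ t j → fold (start j) mate t
    ; path-∈ = λ t t≤r j → walk-∈ (start-∈ j) t t≤r
    ; path-edge = λ t t<r j → walk-edge (start-∈ j) t t<r
    ; path-injective = λ t t≤r j j′ eq → start-injective j j′ (walk-injective (start-∈ j) (start-∈ j′) t t≤r eq)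
    }

  -- Holds by refl, but stating it spares users from unfolding paths, whose mate is computed by Hall's theorem.
  paths-start : ∀ {k} start start-∈ start-injective j → DisjointPaths.path (paths {k} start start-∈ start-injective) 0 j ≡ start j
  paths-start _ _ _ _ = refl

reverse-paths : ∀ {n} {G : Graph n} {Y r k} → DisjointPaths G (λ t → Y (r ∸ t)) r k → DisjointPaths G Y r k
reverse-paths {G = G} {Y} {r} P = record
  { path = λ t → path (r ∸ t)
  ; path-∈ = λ t t≤r j → subst (λ i → Y i (path (r ∸ t) j) ≡ true) (m∸[m∸n]≡n t≤r) (path-∈ (r ∸ t) (m∸n≤m r t) j)
  ; path-edge = λ t t<r j → trans (adj-sym G _ _)
      (subst (λ i → adj G (path (r ∸ suc t) j) (path i j) ≡ true) (sym (+-∸-assoc 1 t<r))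
        (path-edge (r ∸ suc t) (∸-monoʳ-< z<s t<r) j))
  ; path-injective = λ t t≤r → path-injective (r ∸ t) (m∸n≤m r t)
  }
  where open DisjointPaths P

split-at : ∀ p (A : ℕ → Set) → (∀ t → t < p → A t) → (∀ t → A (p + t)) → ∀ t → A t
split-at p A below above t with t <? p
... | yes t<p = below t t<p
... | no t≮p = subst A (m+[n∸m]≡n (≮⇒≥ t≮p)) (above (t ∸ p))

module _ {n} {G : Graph n} {Y : ℕ → Fin n → Bool} {p q k : ℕ}
  (P : DisjointPaths G Y p k) (Q : DisjointPaths G (λ t → Y (p + t)) q k)
  (meet : ∀ j → DisjointPaths.path P p j ≡ DisjointPaths.path Q 0 j) where

  private
    module P = DisjointPaths P
    module Q = DisjointPaths Q

    path : ℕ → Fin k → Fin n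
    path t with t <? p
    ... | yes _ = P.path t
    ... | no _ = Q.path (t ∸ p)

    path-left : ∀ {t} → t ≤ p → ∀ j → path t j ≡ P.path t j
    path-left {t} t≤p j with t <? p
    ... | yes _ = refl
    ... | no t≮p with ≤-antisym t≤p (≮⇒≥ t≮p)
    ...   | refl = trans (cong (λ i → Q.path i j) (n∸n≡0 p)) (sym (meet j))

    path-right : ∀ t j → path (p + t) j ≡ Q.path t j
    path-right t j with p + t <? p
    ... | yes p+t<p = ⊥-elim (m+n≮m p t p+t<p)
    ... | no _ = cong (λ i → Q.path i j) (m+n∸m≡n p t)

  append-paths : DisjointPaths G Y (p + q) k
  append-paths = record
    { path = path
    ; path-∈ = split-at p (λ t → t ≤ p + q → ∀ j → Y t (path t j) ≡ true)
        (λ t t<p _ j → subst (λ v → Y t v ≡ true) (sym (path-left (<⇒≤ t<p) j)) (P.path-∈ t (<⇒≤ t<p) j))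
        (λ t p+t≤p+q j → subst (λ v → Y (p + t) v ≡ true) (sym (path-right t j)) (Q.path-∈ t (+-cancelˡ-≤ p _ _ p+t≤p+q) j))
    ; path-edge = split-at p (λ t → t < p + q → ∀ j → adj G (path t j) (path (suc t) j) ≡ true)
        (λ t t<p _ j → subst₂ (λ v w → adj G v w ≡ true) (sym (path-left (<⇒≤ t<p) j)) (sym (path-left t<p j))
                         (P.path-edge t t<p j))
        (λ t p+t<p+q j → subst₂ (λ v w → adj G v w ≡ true) (sym (path-right t j))
                           (sym (trans (cong (λ i → path i j) (sym (+-suc p t))) (path-right (suc t) j)))
                           (Q.path-edge t (+-cancelˡ-< p _ _ p+t<p+q) j))
    ; path-injective = split-at p (λ t → t ≤ p + q → ∀ j j′ → path t j ≡ path t j′ → j ≡ j′)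
        (λ t t<p _ j j′ eq → P.path-injective t (<⇒≤ t<p) j j′
                              (trans (sym (path-left (<⇒≤ t<p) j)) (trans eq (path-left (<⇒≤ t<p) j′))))
        (λ t p+t≤p+q j j′ eq → Q.path-injective t (+-cancelˡ-≤ p _ _ p+t≤p+q) j j′
                                (trans (sym (path-right t j)) (trans eq (path-right t j′))))
    }

-- The layers of the theorem

count-lookup : ∀ {n} (V : Subset n) → count (lookup V) ≡ ∣ V ∣
count-lookup [] = refl
count-lookup (true ∷ V) = cong suc (count-lookup V)
count-lookup (false ∷ V) = count-lookup V

degIn≡deg : ∀ {n} (G : Graph n) v (B : Subset n) → degIn G v B ≡ deg G v (lookup B)
degIn≡deg G v B = trans (sym (count-lookup (N G v ∩ˢ B)))
  (count-cong λ w → trans (lookup-zipWith _∧_ w (N G v) B) (cong (_∧ lookup B w) (lookup∘tabulate (adj G v) w)))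

to-NonEmptyBiregular : ∀ {n} {G : Graph n} {A B : Subset n} {A′ B′ : Fin n → Bool} →
  (∀ x → A′ x ≡ lookup A x) → (∀ x → B′ x ≡ lookup B x) →
  NonEmpty G A B × Biregular G A B → NonEmptyBiregular G A′ B′
to-NonEmptyBiregular {n} {G} {A} {B} A′≗A B′≗B ((v , w , v∈A , w∈B , vw) , (d₁ , d₂ , deg-A , deg-B)) = record
  { d₁ = d₁
  ; d₂ = d₂
  ; deg-A = λ x x∈ → trans (count-cong λ y → cong (adj G x y ∧_) (B′≗B y)) (trans (sym (degIn≡deg G x B)) (deg-A x (∈ᵇ A′≗A x∈)))
  ; deg-B = λ y y∈ → trans (count-cong λ x → cong (adj G y x ∧_) (A′≗A x)) (trans (sym (degIn≡deg G y A)) (deg-B y (∈ᵇ B′≗B y∈)))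
  ; edge = v , w , trans (A′≗A v) ([]=⇒lookup v∈A) , trans (B′≗B w) ([]=⇒lookup w∈B) , vw
  }
  where
  ∈ᵇ : ∀ {P : Fin n → Bool} {V : Subset n} → (∀ x → P x ≡ lookup V x) → ∀ {x} → P x ≡ true → x ∈ V
  ∈ᵇ P≗V {x} Px = lookup⇒[]= x _ (trans (sym (P≗V x)) Px)

minOver-≤ : ∀ m (f : Fin (suc m) → ℕ) i → minOver m f ≤ f i
minOver-≤ zero f fzero = ≤-refl
minOver-≤ (suc m) f fzero = m⊓n≤m (f fzero) _
minOver-≤ (suc m) f (fsuc i) = ≤-trans (m⊓n≤n (f fzero) _) (minOver-≤ m (f ∘ fsuc) i)

minOver-attained : ∀ m (f : Fin (suc m) → ℕ) → Σ (Fin (suc m)) λ i → f i ≡ minOver m f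
minOver-attained zero f = fzero , refl
minOver-attained (suc m) f with ≤-total (f fzero) (minOver m (f ∘ fsuc))
... | inj₁ f₀≤ = fzero , sym (m≤n⇒m⊓n≡m f₀≤)
... | inj₂ ≤f₀ = let i , fi≡ = minOver-attained m (f ∘ fsuc) in fsuc i , trans fi≡ (sym (m≥n⇒m⊓n≡n ≤f₀))

enumerate : ∀ {n} (P : Fin n → Bool) →
  Σ (Fin (count P) → Fin n) λ e → (∀ j → P (e j) ≡ true) × (∀ j j′ → e j ≡ e j′ → j ≡ j′)
enumerate {zero} P = (λ ()) , (λ ()) , (λ ())
enumerate {suc n} P with P fzero in P₀ | enumerate (P ∘ fsuc)
... | false | e , e-∈ , e-injective = fsuc ∘ e , e-∈ , λ j j′ eq → e-injective j j′ (Finₚ.suc-injective eq)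
... | true | e , e-∈ , e-injective = e′ , e′-∈ , e′-injective
  where
  e′ : Fin (suc (count (P ∘ fsuc))) → Fin (suc n)
  e′ fzero = fzero
  e′ (fsuc j) = fsuc (e j)
  e′-∈ : ∀ j → P (e′ j) ≡ true
  e′-∈ fzero = P₀
  e′-∈ (fsuc j) = e-∈ j
  e′-injective : ∀ j j′ → e′ j ≡ e′ j′ → j ≡ j′
  e′-injective fzero fzero _ = refl
  e′-injective (fsuc j) (fsuc j′) eq = cong fsuc (e-injective j j′ (Finₚ.suc-injective eq))

module Layering {n} (G : Graph n) (m : ℕ) (X : Fin (suc m) → Subset n)
  (X-disjoint : ∀ i j → i ≢ j → Disjoint (X i) (X j))
  (X-biregular : ∀ (i : Fin m) → NonEmpty G (X (inject₁ i)) (X (fsuc i)) × Biregular G (X (inject₁ i)) (X (fsuc i)))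
  where

  -- X indexed by ℕ; the layers beyond m are empty.
  layer : ℕ → Fin n → Bool
  layer t x with t <? suc m
  ... | yes t<1+m = lookup (X (fromℕ< t<1+m)) x
  ... | no _ = false

  layer-toℕ : ∀ (i : Fin (suc m)) x → layer (toℕ i) x ≡ lookup (X i) x
  layer-toℕ i x with toℕ i <? suc m
  ... | yes i<1+m = cong (λ i → lookup (X i) x) (Finₚ.fromℕ<-toℕ i i<1+m)
  ... | no i≮1+m = ⊥-elim (i≮1+m (Finₚ.toℕ<n i))

  layer-at : ∀ (i : Fin (suc m)) {t} → toℕ i ≡ t → ∀ x → layer t x ≡ lookup (X i) x
  layer-at i refl = layer-toℕ i

  index : ∀ {t} → t ≤ m → Fin (suc m)
  index t≤m = fromℕ< (s≤s t≤m)

  layer-index : ∀ {t} (t≤m : t ≤ m) x → layer t x ≡ lookup (X (index t≤m)) x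
  layer-index t≤m = layer-at (index t≤m) (Finₚ.toℕ-fromℕ< (s≤s t≤m))

  count-layer : ∀ {t} (t≤m : t ≤ m) → count (layer t) ≡ ∣ X (index t≤m) ∣
  count-layer t≤m = trans (count-cong (layer-index t≤m)) (count-lookup (X (index t≤m)))

  layers-disjoint : LayersDisjoint layer m
  layers-disjoint i j i≤m j≤m i≢j x Yix with layer j x in Yjx
  ... | false = refl
  ... | true = ⊥-elim (X-disjoint (index i≤m) (index j≤m) (i≢j ∘ index-injective) x (∈X i≤m Yix) (∈X j≤m Yjx))
    where
    index-injective : index i≤m ≡ index j≤m → i ≡ j
    index-injective eq = trans (sym (Finₚ.toℕ-fromℕ< (s≤s i≤m))) (trans (cong toℕ eq) (Finₚ.toℕ-fromℕ< (s≤s j≤m)))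
    ∈X : ∀ {t} (t≤m : t ≤ m) → layer t x ≡ true → x ∈ X (index t≤m)
    ∈X t≤m Ytx = lookup⇒[]= x _ (trans (sym (layer-index t≤m x)) Ytx)

  layers-biregular : ∀ t → t < m → NonEmptyBiregular G (layer t) (layer (suc t))
  layers-biregular t t<m = to-NonEmptyBiregular {A = X (inject₁ q)} {X (fsuc q)} {layer t} {layer (suc t)}
    (layer-at (inject₁ q) (trans (Finₚ.toℕ-inject₁ q) (Finₚ.toℕ-fromℕ< t<m)))
    (layer-at (fsuc q) (cong suc (Finₚ.toℕ-fromℕ< t<m)))
    (X-biregular q)
    where
    q = fromℕ< t<m

  k : ℕ
  k = minOver m λ i → ∣ X i ∣

  pivot : Σ (Fin (suc m)) λ i → ∣ X i ∣ ≡ k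
  pivot = minOver-attained m λ i → ∣ X i ∣

  p : ℕ
  p = toℕ (proj₁ pivot)

  p≤m : p ≤ m
  p≤m = ≤-pred (Finₚ.toℕ<n (proj₁ pivot))

  count-pivot : count (layer p) ≡ k
  count-pivot = trans (count-cong (layer-toℕ (proj₁ pivot))) (trans (count-lookup (X (proj₁ pivot))) (proj₂ pivot))

  pivot-smallest : ∀ t → t ≤ m → count (layer p) ≤ count (layer t)
  pivot-smallest t t≤m = subst₂ _≤_ (sym count-pivot) (sym (count-layer t≤m)) (minOver-≤ m _ (index t≤m))

  start : Σ (Fin k → Fin n) λ e → (∀ j → layer p (e j) ≡ true) × (∀ j j′ → e j ≡ e j′ → j ≡ j′)
  start = subst (λ c → Σ (Fin c → Fin n) λ e → (∀ j → layer p (e j) ≡ true) × (∀ j j′ → e j ≡ e j′ → j ≡ j′))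
                count-pivot (enumerate (layer p))

  within-backward : ∀ i → p ∸ i ≤ m
  within-backward i = ≤-trans (m∸n≤m p i) p≤m

  within-onward : ∀ {i} → i ≤ m ∸ p → p + i ≤ m
  within-onward i≤ = ≤-trans (+-monoʳ-≤ p i≤) (≤-reflexive (m+[n∸m]≡n p≤m))

  module Backward = LayeredPaths G (λ t → layer (p ∸ t)) p
    (λ i j i≤p j≤p i≢j → layers-disjoint (p ∸ i) (p ∸ j) (within-backward i) (within-backward j) (i≢j ∘ ∸-cancelˡ-≡ i≤p j≤p))
    (λ i i<p → subst (λ t → NonEmptyBiregular G (layer t) (layer (p ∸ suc i))) (sym (+-∸-assoc 1 i<p))
                 (NonEmptyBiregular-sym (layers-biregular (p ∸ suc i) (<-≤-trans (∸-monoʳ-< z<s i<p) p≤m))))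
    (λ i _ → pivot-smallest (p ∸ i) (within-backward i))

  module Onward = LayeredPaths G (λ t → layer (p + t)) (m ∸ p)
    (λ i j i≤ j≤ i≢j → layers-disjoint (p + i) (p + j) (within-onward i≤) (within-onward j≤) (i≢j ∘ +-cancelˡ-≡ p i j))
    (λ i i< → subst (λ t → NonEmptyBiregular G (layer (p + i)) (layer t)) (sym (+-suc p i))
                (layers-biregular (p + i) (subst (p + i <_) (m+[n∸m]≡n p≤m) (+-monoʳ-< p i<))))
    (λ i i≤ → subst (λ t → count (layer t) ≤ count (layer (p + i))) (sym (+-identityʳ p))
                (pivot-smallest (p + i) (within-onward i≤)))

  start-∈′ : ∀ j → layer (p + 0) (proj₁ start j) ≡ true
  start-∈′ j = subst (λ t → layer t (proj₁ start j) ≡ true) (sym (+-identityʳ p)) (proj₁ (proj₂ start) j)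

  backward : DisjointPaths G (λ t → layer (p ∸ t)) p k
  backward = Backward.paths (proj₁ start) (proj₁ (proj₂ start)) (proj₂ (proj₂ start))

  onward : DisjointPaths G (λ t → layer (p + t)) (m ∸ p) k
  onward = Onward.paths (proj₁ start) start-∈′ (proj₂ (proj₂ start))

  paths-meet : ∀ j → DisjointPaths.path backward (p ∸ p) j ≡ DisjointPaths.path onward 0 j
  paths-meet j = begin
    DisjointPaths.path backward (p ∸ p) j ≡⟨ cong (λ t → DisjointPaths.path backward t j) (n∸n≡0 p) ⟩
    DisjointPaths.path backward 0 j       ≡⟨ Backward.paths-start (proj₁ start) (proj₁ (proj₂ start)) (proj₂ (proj₂ start)) j ⟩
    proj₁ start j                         ≡⟨ Onward.paths-start (proj₁ start) start-∈′ (proj₂ (proj₂ start)) j ⟨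
    DisjointPaths.path onward 0 j         ∎
    where open ≡-Reasoning

  paths : DisjointPaths G layer m k
  paths = subst (λ r → DisjointPaths G layer r k) (m+[n∸m]≡n p≤m) (append-paths (reverse-paths backward) onward paths-meet)

lemma4p15 : ∀ {n} (G : Graph n) (m : ℕ) (X : Fin (suc m) → Subset n)
    → (∀ i j → i ≢ j → Disjoint (X i) (X j))
    → (∀ (i : Fin m) → NonEmpty G (X (inject₁ i)) (X (fsuc i)) × Biregular G (X (inject₁ i)) (X (fsuc i)))
    → Σ (Fin (suc m) → Fin (minOver m (λ i → ∣ X i ∣)) → Fin n) λ v →
        (∀ i j i′ j′ → v i j ≡ v i′ j′ → (i ≡ i′ × j ≡ j′))
        × (∀ i j → v i j ∈ X i)
        × (∀ (i : Fin m) j → adj G (v (inject₁ i) j) (v (fsuc i) j) ≡ true)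
lemma4p15 {n} G m X X-disjoint X-biregular = v , v-injective , v-∈ , v-edge
  where
  open Layering G m X X-disjoint X-biregular using (k; layer-toℕ; paths)
  open DisjointPaths paths
  v : Fin (suc m) → Fin k → Fin n
  v i = path (toℕ i)
  v-∈ : ∀ i j → v i j ∈ X i
  v-∈ i j = lookup⇒[]= _ (X i) (trans (sym (layer-toℕ i _)) (path-∈ (toℕ i) (≤-pred (Finₚ.toℕ<n i)) j))
  v-injective : ∀ i j i′ j′ → v i j ≡ v i′ j′ → i ≡ i′ × j ≡ j′
  v-injective i j i′ j′ eq =
    i≡i′ , path-injective (toℕ i) (≤-pred (Finₚ.toℕ<n i)) j j′ (trans eq (cong (λ i → v i j′) (sym i≡i′)))
    where
    i≡i′ : i ≡ i′
    i≡i′ = decidable-stable (i ≟ᶠ i′) λ i≢i′ → X-disjoint i i′ i≢i′ _ (v-∈ i j) (subst (_∈ X i′) (sym eq) (v-∈ i′ j′))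
  v-edge : ∀ (i : Fin m) j → adj G (v (inject₁ i) j) (v (fsuc i) j) ≡ true
  v-edge i j = subst (λ t → adj G (path t j) (path (suc (toℕ i)) j) ≡ true) (sym (Finₚ.toℕ-inject₁ i))
                 (path-edge (toℕ i) (Finₚ.toℕ<n i) j)
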